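{- Let $e\geq2$, $l\geq1$, $\mathbf{s}=(s_1,\ldots,s_l)\in\overline{\mathcal{A}}^l_e$, $s=\sum_{i=1}^l s_i$, and let $\boldsymbol{\lambda},\boldsymbol{\mu}$ be $l$-partitions. Then $$\mathcal{C}_{e,s}(\tau_{e,\mathbf{s}}(\boldsymbol{\lambda}))=\mathcal{C}_{e,s}(\tau_{e,\mathbf{s}}(\boldsymbol{\mu}))\iff\mathcal{C}_{e,\mathbf{s}}(\boldsymbol{\lambda})=\mathcal{C}_{e,\mathbf{s}}(\boldsymbol{\mu}).$$
   Context: A partition is a nonincreasing sequence $\lambda=(\lambda_1\geq\lambda_2\geq\cdots)$ of nonnegative integers with finitely many nonzero terms; an $l$-partition $\boldsymbol{\lambda}=(\lambda^1,\ldots,\lambda^l)$ is an $l$-tuple of partitions, with nodes $(a,b,c)$ for $a\geq1$, $1\leq c\leq l$, $1\leq b\leq\lambda^c_a$. For $\mathbf{s}\in\mathbb{Z}^l$, the residue of node $(a,b,c)$ is $b-a+s_c\bmod e$, $c^{e,\mathbf{s}}_i(\boldsymbol{\lambda})$ is the number of nodes of residue $i$, and $\mathcal{C}_{e,\mathbf{s}}(\boldsymbol{\lambda})=(c^{e,\mathbf{s}}_0(\boldsymbol{\lambda}),\ldots,c^{e,\mathbf{s}}_{e-1}(\boldsymbol{\lambda}))$; for a partition with a charge $s\in\mathbb{Z}$ ($l=1$), $\mathcal{C}_{e,s}$ is defined likewise. For a partition $\lambda$ and $s\in\mathbb{Z}$, $L_s(\lambda)=\{\lambda_j-j+s:j\geq1\}$;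 every subset $L\subset\mathbb{Z}$ containing all sufficiently negative integers and no sufficiently large ones equals $L_t(\mu)$ for a unique partition $\mu$ (the partition associated with $L$) and unique $t$. $\overline{\mathcal{A}}^l_e=\{(s_1,\ldots,s_l)\in\mathbb{Z}^l: 0\leq s_j-s_i\leq e\text{ for all }i<j\}$. Uglov map: $\tau_{e,\mathbf{s}}(\boldsymbol{\lambda})$ is the partition associated with the set of all integers $(l-c)e+qel+r$, where $c\in\{1,\ldots,l\}$ and $k=qe+r\in L_{s_c}(\lambda^c)$ with $q\in\mathbb{Z}$, $r\in\{0,\ldots,e-1\}$. -}

module Defs where

open import Data.Nat as ℕ using (ℕ; zero; suc; NonZero)
open import Data.Integer as ℤ using (ℤ; +_)
open import Data.Integer.DivMod using (_/ℕ_; _%ℕ_)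
open import Data.List using (List; []; _∷_)
open import Data.List.Relation.Unary.Linked using (Linked)
open import Data.Vec as Vec using (Vec; lookup; tabulate)
open import Data.Fin as Fin using (Fin; toℕ)
open import Data.Bool using (if_then_else_)
open import Data.Product using (Σ; ∃; _×_)
open import Relation.Nullary using (does)
open import Relation.Binary.PropositionalEquality using (_≡_)
open import Function.Bundles using (_⇔_)

-- A partition: a nonincreasing finite list of parts; λ_j = 0 beyond the list.
-- (Trailing zero entries are allowed and harmless.)
record Partition : Set where
  constructor mkPartition
  field
    parts   : List ℕ
    nonincr : Linked ℕ._≥_ parts
open Partition public

-- 0-based access: at λ i = λ_{i+1}, and 0 past the end of the list.
at : List ℕ → ℕ → ℕ
at []       _       = 0
at (x ∷ xs) zero    = x
at (x ∷ xs) (suc i) = at xs i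

-- λ_j for j ≥ 1 (part λ j with j = 0 is not used)
part : Partition → ℕ → ℕ
part λp j = at (parts λp) (j ℕ.∸ 1)

InL : ℤ → Partition → ℤ → Set
InL s λp k = Σ ℕ λ j → (1 ℕ.≤ j) × (k ≡ (+ part λp j ℤ.- + j) ℤ.+ s)

MultiPartition : ℕ → Set
MultiPartition l = Vec Partition l

residue : (e : ℕ) .{{_ : NonZero e}} → ℤ → ℕ → ℕ → ℕ
residue e s a b = ((+ b ℤ.- + a) ℤ.+ s) %ℕ e

countRow : (e : ℕ) .{{_ : NonZero e}} → ℤ → ℕ → ℕ → ℕ → ℕ
countRow e s a zero    i = 0
countRow e s a (suc b) i =
  countRow e s a b i ℕ.+ (if does (residue e s a (suc b) ℕ.≟ i) then 1 else 0)

countRows : (e : ℕ) .{{_ : NonZero e}} → ℤ → ℕ → List ℕ → ℕ → ℕ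
countRows e s a []         i = 0
countRows e s a (r ∷ rows) i = countRow e s a r i ℕ.+ countRows e s (suc a) rows i

contentCount : (e : ℕ) .{{_ : NonZero e}} → ℤ → Partition → ℕ → ℕ
contentCount e s λp i = countRows e s 1 (parts λp) i

Content : (e : ℕ) .{{_ : NonZero e}} → ℤ → Partition → Vec ℕ e
Content e s λp = tabulate λ (i : Fin e) → contentCount e s λp (toℕ i)

sumFin : (l : ℕ) → (Fin l → ℕ) → ℕ
sumFin zero    f = 0
sumFin (suc l) f = f Fin.zero ℕ.+ sumFin l (λ i → f (Fin.suc i))

multiContentCount : (e : ℕ) .{{_ : NonZero e}} → (l : ℕ) → Vec ℤ l → MultiPartition l → ℕ → ℕ
multiContentCount e l s λs i = sumFin l λ c → contentCount e (lookup s c) (lookup λs c) i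

MultiContent : (e : ℕ) .{{_ : NonZero e}} → (l : ℕ) → Vec ℤ l → MultiPartition l → Vec ℕ e
MultiContent e l s λs = tabulate λ (i : Fin e) → multiContentCount e l s λs (toℕ i)

sumℤ : (l : ℕ) → Vec ℤ l → ℤ
sumℤ l s = Vec.foldr _ ℤ._+_ (+ 0) s

InAlcove : (e l : ℕ) → Vec ℤ l → Set
InAlcove e l s = ∀ (i j : Fin l) → i Fin.< j →
  (+ 0 ℤ.≤ lookup s j ℤ.- lookup s i) × (lookup s j ℤ.- lookup s i ℤ.≤ + e)

-- Component c ∈ {1..l} is represented by c' : Fin l with c = toℕ c' + 1, so l - c = l - 1 - toℕ c'.
UglovSet : (e : ℕ) .{{_ : NonZero e}} → (l : ℕ) → Vec ℤ l → MultiPartition l → ℤ → Set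
UglovSet e l s λs m = Σ (Fin l) λ c → Σ ℤ λ k →
  InL (lookup s c) (lookup λs c) k ×
  (m ≡ (+ ((l ℕ.∸ suc (toℕ c)) ℕ.* e) ℤ.+ (k /ℕ e) ℤ.* + (e ℕ.* l)) ℤ.+ + (k %ℕ e))

IsAssociated : (ℤ → Set) → Partition → Set
IsAssociated L μ = Σ ℤ λ t → ∀ (k : ℤ) → InL t μ k ⇔ L k

IsUglov : (e : ℕ) .{{_ : NonZero e}} → (l : ℕ) → Vec ℤ l → MultiPartition l → Partition → Set
IsUglov e l s λs μ = IsAssociated (UglovSet e l s λs) μ

module Submission where

-- For an l-partition λ with multicharge s, a residue i and the
-- counting function G_i(K) = #{ j ≤ K : j ≡ i mod e }, we prove for large B the identity
--   c_i(τ(λ)) + X_i(B) = (l - 1) c_0(λ) + c_i(λ) + K_i(B),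
-- where c_i(τ(λ)) is taken at charge s₁ + … + s_l, c_i(λ) is the multicharge content, and the
-- correction terms X, K depend only on e, s and B.  Taking i = 0 recovers c_0(λ) from the contents
-- of τ(λ), and then every c_i(λ); this gives the theorem.
-- The identity is an abacus computation.  (1) Contents as bead sums: if the charge is Q e + N then
-- c_i(λ) + ∑_{k<N} G_i(k) = ∑_{beads b} G_i(b), summing over the N largest beads of the Maya
-- diagram.  (2) The Uglov set places the bead k = q e + r of component c at (l - c) e + r + q e l;
-- so a window of whole periods on the Uglov abacus splits into windows on the component abaci,
-- and bead sums with matching weights split accordingly.  (3) With weights G_i + (l - 1) on the
-- Uglov side and (l - 1) G_0 + G_i + (l - c) on component c, (1) and (2) give the identity.

open import Defs
open import Data.Nat as ℕ using (ℕ; zero; suc; NonZero; _+_; _*_; _∸_; _≤_; _<_; z≤n; s≤s)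
import Data.Nat.Properties as ℕₚ
open import Data.Nat.Tactic.RingSolver using (solve-∀)
open import Algebra.Properties.CommutativeSemigroup ℕₚ.+-commutativeSemigroup using (interchange)
open import Data.Fin as Fin using (Fin; toℕ)
open import Data.Fin.Properties using (toℕ-injective; toℕ<n)
open import Data.Vec using (Vec; lookup; tabulate; _∷_; [])
open import Data.Vec.Properties using (lookup∘tabulate; tabulate-cong)
open import Data.Nat.DivMod using (_%_; _/_; [m+kn]%n≡m%n; m<n⇒m%n≡m; m%n<n; m≡m%n+[m/n]*n)
open import Data.Integer as ℤ using (ℤ; +_; -[1+_]; -_; _-_; ∣_∣)
import Data.Integer.Properties as ℤₚ
open import Data.Integer.DivMod using (_/ℕ_; _%ℕ_; n%ℕd<d; a≡a%ℕn+[a/ℕn]*n)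
import Data.Integer.Tactic.RingSolver as ℤ-Solver
open import Data.Bool using (if_then_else_)
open import Data.Product using (Σ; _×_; _,_; proj₁; proj₂)
open import Data.Empty using (⊥; ⊥-elim)
open import Data.Sum using (_⊎_; inj₁; inj₂)
open import Data.List using (List; []; _∷_; length)
open import Data.List.Relation.Unary.Linked using (Linked; [-]; _∷_)
import Data.List.Relation.Unary.Linked as Linked
open import Relation.Nullary using (Dec; yes; no; does; ¬_)
import Relation.Nullary.Decidable as Dec
open import Relation.Nullary.Decidable using (_⊎-dec_)
open import Function.Bundles using (_⇔_; mk⇔; Equivalence)
import Function.Properties.Equivalence as ⇔
open import Relation.Binary.PropositionalEquality

sumBelow : ℕ → (ℕ → ℕ) → ℕ
sumBelow zero    f = 0
sumBelow (suc n) f = sumBelow n f + f n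

syntax sumBelow n (λ k → x) = ∑[ k < n ] x

∑-cong : ∀ n {f g : ℕ → ℕ} → (∀ k → k < n → f k ≡ g k) → ∑[ k < n ] f k ≡ ∑[ k < n ] g k
∑-cong zero    f≡g = refl
∑-cong (suc n) f≡g =
  cong₂ _+_ (∑-cong n (λ k k<n → f≡g k (ℕₚ.m≤n⇒m≤1+n k<n))) (f≡g n ℕₚ.≤-refl)

∑-vanishes : ∀ n (f : ℕ → ℕ) → (∀ k → k < n → f k ≡ 0) → ∑[ k < n ] f k ≡ 0
∑-vanishes n f f≡0 = trans (∑-cong n f≡0) (zeros n)
  where
  zeros : ∀ n → ∑[ k < n ] 0 ≡ 0
  zeros zero    = refl
  zeros (suc n) = cong (_+ 0) (zeros n)

∑-const : ∀ n c → ∑[ k < n ] c ≡ n * c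
∑-const zero    c = refl
∑-const (suc n) c = trans (cong (_+ c) (∑-const n c)) (ℕₚ.+-comm (n * c) c)

∑-split : ∀ a b (f : ℕ → ℕ) → ∑[ k < a + b ] f k ≡ ∑[ k < a ] f k + ∑[ j < b ] f (a + j)
∑-split a zero    f = trans (cong (λ n → sumBelow n f) (ℕₚ.+-identityʳ a)) (sym (ℕₚ.+-identityʳ _))
∑-split a (suc b) f = begin
  ∑[ k < a + suc b ] f k                              ≡⟨ cong (λ n → sumBelow n f) (ℕₚ.+-suc a b) ⟩
  ∑[ k < a + b ] f k + f (a + b)                      ≡⟨ cong (_+ f (a + b)) (∑-split a b f) ⟩
  ∑[ k < a ] f k + ∑[ j < b ] f (a + j) + f (a + b)   ≡⟨ ℕₚ.+-assoc (sumBelow a f) _ _ ⟩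
  ∑[ k < a ] f k + (∑[ j < b ] f (a + j) + f (a + b)) ∎
  where open ≡-Reasoning

∑-+ : ∀ n (f g : ℕ → ℕ) → ∑[ k < n ] (f k + g k) ≡ ∑[ k < n ] f k + ∑[ k < n ] g k
∑-+ zero    f g = refl
∑-+ (suc n) f g =
  trans (cong (_+ (f n + g n)) (∑-+ n f g)) (interchange (sumBelow n f) (sumBelow n g) (f n) (g n))

∑-*ˡ : ∀ n a (f : ℕ → ℕ) → ∑[ k < n ] (a * f k) ≡ a * ∑[ k < n ] f k
∑-*ˡ zero    a f = sym (ℕₚ.*-zeroʳ a)
∑-*ˡ (suc n) a f = trans (cong (_+ a * f n) (∑-*ˡ n a f)) (sym (ℕₚ.*-distribˡ-+ a _ (f n)))

∑-blocks : ∀ a b (f : ℕ → ℕ) → ∑[ k < a * b ] f k ≡ ∑[ q < a ] ∑[ j < b ] f (q * b + j)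
∑-blocks zero    b f = refl
∑-blocks (suc a) b f = begin
  ∑[ k < b + a * b ] f k                            ≡⟨ cong (λ n → sumBelow n f) (ℕₚ.+-comm b (a * b)) ⟩
  ∑[ k < a * b + b ] f k                            ≡⟨ ∑-split (a * b) b f ⟩
  ∑[ k < a * b ] f k + ∑[ j < b ] f (a * b + j)     ≡⟨ cong (_+ ∑[ j < b ] f (a * b + j)) (∑-blocks a b f) ⟩
  ∑[ q < a ] ∑[ j < b ] f (q * b + j) + ∑[ j < b ] f (a * b + j) ∎
  where open ≡-Reasoning

∑-swap : ∀ a b (F : ℕ → ℕ → ℕ) → ∑[ q < a ] ∑[ d < b ] F q d ≡ ∑[ d < b ] ∑[ q < a ] F q d
∑-swap zero    b F = sym (∑-vanishes b (λ _ → 0) (λ _ _ → refl))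
∑-swap (suc a) b F =
  trans (cong (_+ ∑[ d < b ] F a d) (∑-swap a b F)) (sym (∑-+ b (λ d → ∑[ q < a ] F q d) (F a)))

sumFin-reverse : ∀ l (F : ℕ → ℕ) → ∑[ d < l ] F d ≡ sumFin l (λ c → F (l ∸ suc (toℕ c)))
sumFin-reverse zero    F = refl
sumFin-reverse (suc l) F = trans (cong (_+ F l) (sumFin-reverse l F)) (ℕₚ.+-comm _ (F l))

sumFin-cong : ∀ l {f g : Fin l → ℕ} → (∀ c → f c ≡ g c) → sumFin l f ≡ sumFin l g
sumFin-cong zero    f≡g = refl
sumFin-cong (suc l) f≡g = cong₂ _+_ (f≡g Fin.zero) (sumFin-cong l (λ c → f≡g (Fin.suc c)))

sumFin-+ : ∀ l (f g : Fin l → ℕ) → sumFin l (λ c → f c + g c) ≡ sumFin l f + sumFin l g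
sumFin-+ zero    f g = refl
sumFin-+ (suc l) f g =
  trans (cong (_+_ (f Fin.zero + g Fin.zero)) (sumFin-+ l (λ c → f (Fin.suc c)) (λ c → g (Fin.suc c))))
        (interchange (f Fin.zero) (g Fin.zero) (sumFin l (λ c → f (Fin.suc c))) (sumFin l (λ c → g (Fin.suc c))))

sumFin-*ˡ : ∀ l a (f : Fin l → ℕ) → sumFin l (λ c → a * f c) ≡ a * sumFin l f
sumFin-*ˡ zero    a f = sym (ℕₚ.*-zeroʳ a)
sumFin-*ˡ (suc l) a f =
  trans (cong (_+_ (a * f Fin.zero)) (sumFin-*ˡ l a (λ c → f (Fin.suc c)))) (sym (ℕₚ.*-distribˡ-+ a _ _))

sumFin-affine : ∀ l a (f g h : Fin l → ℕ) →
  sumFin l (λ c → (a * f c + g c) + h c) ≡ a * sumFin l f + sumFin l g + sumFin l h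
sumFin-affine l a f g h = begin
  sumFin l (λ c → (a * f c + g c) + h c)                 ≡⟨ sumFin-+ l (λ c → a * f c + g c) h ⟩
  sumFin l (λ c → a * f c + g c) + sumFin l h            ≡⟨ cong (_+ sumFin l h) (sumFin-+ l (λ c → a * f c) g) ⟩
  sumFin l (λ c → a * f c) + sumFin l g + sumFin l h     ≡⟨ cong (λ x → x + sumFin l g + sumFin l h) (sumFin-*ˡ l a f) ⟩
  a * sumFin l f + sumFin l g + sumFin l h ∎
  where open ≡-Reasoning

sumFin-≤ : ∀ l (f : Fin l → ℕ) (c : Fin l) → f c ≤ sumFin l f
sumFin-≤ (suc l) f Fin.zero    = ℕₚ.m≤m+n _ _
sumFin-≤ (suc l) f (Fin.suc c) = ℕₚ.≤-trans (sumFin-≤ l (λ c → f (Fin.suc c)) c) (ℕₚ.m≤n+m _ _)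

-- The 0/1 indicator of a decided proposition; Defs counts nodes with exactly this shape.
𝟙 : {P : Set} → Dec P → ℕ
𝟙 d = if does d then 1 else 0

𝟙-yes : {P : Set} (d : Dec P) → P → 𝟙 d ≡ 1
𝟙-yes (yes _) _ = refl
𝟙-yes (no ¬p) p = ⊥-elim (¬p p)

𝟙-no : {P : Set} (d : Dec P) → ¬ P → 𝟙 d ≡ 0
𝟙-no (yes p) ¬p = ⊥-elim (¬p p)
𝟙-no (no _)  _  = refl

𝟙-cong : {P Q : Set} (dP : Dec P) (dQ : Dec Q) → P ⇔ Q → 𝟙 dP ≡ 𝟙 dQ
𝟙-cong (yes p) dQ P⇔Q = sym (𝟙-yes dQ (Equivalence.to P⇔Q p))
𝟙-cong (no ¬p) dQ P⇔Q = sym (𝟙-no dQ (λ q → ¬p (Equivalence.from P⇔Q q)))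

∑-𝟙-point : ∀ n i → i < n → ∑[ j < n ] 𝟙 (j ℕ.≟ i) ≡ 1
∑-𝟙-point n i i<n = begin
  ∑[ j < n ] χ j                                           ≡⟨ cong (λ m → sumBelow m χ) (ℕₚ.m+[n∸m]≡n i<n) ⟨
  ∑[ j < suc i + (n ∸ suc i) ] χ j                         ≡⟨ ∑-split (suc i) (n ∸ suc i) χ ⟩
  ∑[ j < i ] χ j + χ i + ∑[ j < n ∸ suc i ] χ (suc i + j)  ≡⟨ cong₂ (λ a b → a + χ i + b) below above ⟩
  0 + χ i + 0                                              ≡⟨ cong (_+ 0) (𝟙-yes (i ℕ.≟ i) refl) ⟩
  1 ∎
  where
  open ≡-Reasoning
  χ : ℕ → ℕ
  χ j = 𝟙 (j ℕ.≟ i)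
  below : ∑[ j < i ] χ j ≡ 0
  below = ∑-vanishes i χ (λ j j<i → 𝟙-no (j ℕ.≟ i) (ℕₚ.<⇒≢ j<i))
  above : ∑[ j < n ∸ suc i ] χ (suc i + j) ≡ 0
  above = ∑-vanishes (n ∸ suc i) (λ j → χ (suc i + j))
                     (λ j _ → 𝟙-no (suc i + j ℕ.≟ i) (λ eq → ℕₚ.m≢1+m+n i (sym eq)))

%-block : ∀ e .{{_ : NonZero e}} q j → j < e → (q * e + j) % e ≡ j
%-block e q j j<e = trans (cong (_% e) (ℕₚ.+-comm (q * e) j)) (trans ([m+kn]%n≡m%n j q e) (m<n⇒m%n≡m j<e))

digits-unique : ∀ e .{{_ : NonZero e}} d r d′ r′ → r < e → r′ < e → d * e + r ≡ d′ * e + r′ →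
  d ≡ d′ × r ≡ r′
digits-unique e d r d′ r′ r<e r′<e eq = d≡ , r≡
  where
  r≡ : r ≡ r′
  r≡ = trans (sym (%-block e d r r<e)) (trans (cong (_% e) eq) (%-block e d′ r′ r′<e))
  d≡ : d ≡ d′
  d≡ = ℕₚ.*-cancelʳ-≡ d d′ e (ℕₚ.+-cancelʳ-≡ r (d * e) (d′ * e) (trans eq (cong (_+_ (d′ * e)) (sym r≡))))

module _ (e : ℕ) .{{_ : NonZero e}} where

  resCount : ℕ → ℕ → ℕ
  resCount i K = ∑[ j < suc K ] 𝟙 (j % e ℕ.≟ i)

  -- Each full period of length e contains exactly one element of every residue class.
  resCount-formula : ∀ i M r → i < e → r < e →
    resCount i (M * e + r) ≡ M + ∑[ j < suc r ] 𝟙 (j ℕ.≟ i)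
  resCount-formula i M r i<e r<e = begin
    ∑[ j < suc (M * e + r) ] χ j                        ≡⟨ cong (λ n → sumBelow n χ) (ℕₚ.+-suc (M * e) r) ⟨
    ∑[ j < M * e + suc r ] χ j                          ≡⟨ ∑-split (M * e) (suc r) χ ⟩
    ∑[ j < M * e ] χ j + ∑[ j < suc r ] χ (M * e + j)   ≡⟨ cong₂ _+_ periods rest ⟩
    M + ∑[ j < suc r ] 𝟙 (j ℕ.≟ i) ∎
    where
    open ≡-Reasoning
    χ : ℕ → ℕ
    χ j = 𝟙 (j % e ℕ.≟ i)
    periods : ∑[ j < M * e ] χ j ≡ M
    periods = begin
      ∑[ j < M * e ] χ j                        ≡⟨ ∑-blocks M e χ ⟩
      ∑[ q < M ] ∑[ j < e ] χ (q * e + j)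
        ≡⟨ ∑-cong M (λ q _ → ∑-cong e (λ j j<e → cong (λ x → 𝟙 (x ℕ.≟ i)) (%-block e q j j<e))) ⟩
      ∑[ q < M ] ∑[ j < e ] 𝟙 (j ℕ.≟ i)         ≡⟨ ∑-cong M (λ _ _ → ∑-𝟙-point e i i<e) ⟩
      ∑[ q < M ] 1                              ≡⟨ ∑-const M 1 ⟩
      M * 1                                     ≡⟨ ℕₚ.*-identityʳ M ⟩
      M ∎
    rest : ∑[ j < suc r ] χ (M * e + j) ≡ ∑[ j < suc r ] 𝟙 (j ℕ.≟ i)
    rest = ∑-cong (suc r) (λ j j≤r →
             cong (λ x → 𝟙 (x ℕ.≟ i)) (%-block e M j (ℕₚ.≤-<-trans (ℕₚ.≤-pred j≤r) r<e)))

private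
  no-wrap : ∀ r r' d k → r < d → + r ≡ + r' ℤ.+ + suc k ℤ.* + d → ⊥
  no-wrap r r' d k r<d eq = ℕₚ.<-irrefl refl (ℕₚ.<-≤-trans r<d d≤r)
    where
    r≡ : r ≡ r' + suc k * d
    r≡ = ℤₚ.+-injective (trans eq (trans (cong (ℤ._+_ (+ r')) (sym (ℤₚ.pos-* (suc k) d)))
                                         (sym (ℤₚ.pos-+ r' (suc k * d)))))
    d≤r : d ≤ r
    d≤r = ℕₚ.≤-trans (ℕₚ.m≤m+n d (k * d))
                     (ℕₚ.≤-trans (ℕₚ.m≤n+m (suc k * d) r') (ℕₚ.≤-reflexive (sym r≡)))

  remainder-gap : ∀ r r' d z → r < d → r' < d → + r ≡ + r' ℤ.+ z ℤ.* + d → z ≡ + 0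
  remainder-gap r r' d (+ zero)  _   _    _  = refl
  remainder-gap r r' d (+ suc k) r<d _    eq = ⊥-elim (no-wrap r r' d k r<d eq)
  remainder-gap r r' d -[1+ k ]  _   r'<d eq = ⊥-elim (no-wrap r' r d k r'<d (flip (+ r) (+ r') -[1+ k ] (+ d) eq))
    where
    flip : ∀ a b z c → a ≡ b ℤ.+ z ℤ.* c → b ≡ a ℤ.+ (- z) ℤ.* c
    flip a b z c refl = cancel b z c
      where
      cancel : ∀ b z c → b ≡ b ℤ.+ z ℤ.* c ℤ.+ (- z) ℤ.* c
      cancel = ℤ-Solver.solve-∀

divMod-unique : ∀ n d .{{_ : NonZero d}} r q → r < d → n ≡ + r ℤ.+ q ℤ.* + d →
  (n %ℕ d ≡ r) × (n /ℕ d ≡ q)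
divMod-unique n d r q r<d n≡ = sym (ℤₚ.+-injective remainders) , ℤₚ.i-j≡0⇒i≡j (n /ℕ d) q quotients
  where
  shift : ∀ a b q q' c → a ℤ.+ q ℤ.* c ≡ b ℤ.+ q' ℤ.* c → a ≡ b ℤ.+ (q' - q) ℤ.* c
  shift a b q q' c eq = trans (sym (cancel a q c)) (trans (cong (_- q ℤ.* c) eq) (regroup b q q' c))
    where
    cancel : ∀ a q c → a ℤ.+ q ℤ.* c - q ℤ.* c ≡ a
    cancel = ℤ-Solver.solve-∀
    regroup : ∀ b q q' c → b ℤ.+ q' ℤ.* c - q ℤ.* c ≡ b ℤ.+ (q' - q) ℤ.* c
    regroup = ℤ-Solver.solve-∀
  gap : + r ≡ + (n %ℕ d) ℤ.+ (n /ℕ d - q) ℤ.* + d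
  gap = shift (+ r) (+ (n %ℕ d)) q (n /ℕ d) (+ d) (trans (sym n≡) (a≡a%ℕn+[a/ℕn]*n n d))
  quotients : n /ℕ d - q ≡ + 0
  quotients = remainder-gap r (n %ℕ d) d (n /ℕ d - q) r<d (n%ℕd<d n d) gap
  remainders : + r ≡ + (n %ℕ d)
  remainders = trans gap (trans (cong (λ z → + (n %ℕ d) ℤ.+ z ℤ.* + d) quotients) (ℤₚ.+-identityʳ _))

%ℕ-shift : ∀ e .{{_ : NonZero e}} (Q : ℤ) (j : ℕ) → (Q ℤ.* + e ℤ.+ + j) %ℕ e ≡ j % e
%ℕ-shift e Q j = proj₁ (divMod-unique (Q ℤ.* + e ℤ.+ + j) e (j % e) (Q ℤ.+ + (j / e)) (m%n<n j e) split)
  where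
  regroup : ∀ Q e r q → Q ℤ.* e ℤ.+ (r ℤ.+ q ℤ.* e) ≡ r ℤ.+ (Q ℤ.+ q) ℤ.* e
  regroup = ℤ-Solver.solve-∀
  j≡ : + j ≡ + (j % e) ℤ.+ + (j / e) ℤ.* + e
  j≡ = trans (cong +_ (m≡m%n+[m/n]*n j e))
             (trans (ℤₚ.pos-+ (j % e) _) (cong (ℤ._+_ (+ (j % e))) (ℤₚ.pos-* (j / e) e)))
  split : Q ℤ.* + e ℤ.+ + j ≡ + (j % e) ℤ.+ (Q ℤ.+ + (j / e)) ℤ.* + e
  split = trans (cong (ℤ._+_ (Q ℤ.* + e)) j≡) (regroup Q (+ e) (+ (j % e)) (+ (j / e)))

InLs : ℤ → List ℕ → ℤ → Set
InLs t ps y = Σ ℕ λ j → (1 ≤ j) × (y ≡ (+ at ps (j ∸ 1) - + j) ℤ.+ t)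

infix 4 _≺_
_≺_ : ℤ → ℤ → Set
y ≺ t = Σ ℕ λ n → t ≡ y ℤ.+ + suc n

InLs-nil : ∀ t y → InLs t [] y ⇔ y ≺ t
InLs-nil t y = mk⇔ to from
  where
  to : InLs t [] y → y ≺ t
  to (suc n , _ , refl) = n , restore (+ suc n) t
    where
    restore : ∀ a t → t ≡ (+ 0 - a) ℤ.+ t ℤ.+ a
    restore = ℤ-Solver.solve-∀
  from : y ≺ t → InLs t [] y
  from (n , refl) = suc n , s≤s z≤n , remove y (+ suc n)
    where
    remove : ∀ y a → y ≡ (+ 0 - a) ℤ.+ (y ℤ.+ a)
    remove = ℤ-Solver.solve-∀

InLs-cons : ∀ t m ps y → InLs t (m ∷ ps) y ⇔ (y ≡ (+ m - + 1) ℤ.+ t ⊎ InLs (t - + 1) ps y)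
InLs-cons t m ps y = mk⇔ to from
  where
  recharge : ∀ a j → (a - + suc (suc j)) ℤ.+ t ≡ (a - + suc j) ℤ.+ (t - + 1)
  recharge a j = trans (cong (λ z → (a - z) ℤ.+ t) (ℤₚ.pos-+ 1 (suc j))) (move a (+ suc j) t)
    where
    move : ∀ a b t → (a - (+ 1 ℤ.+ b)) ℤ.+ t ≡ (a - b) ℤ.+ (t - + 1)
    move = ℤ-Solver.solve-∀
  to : InLs t (m ∷ ps) y → (y ≡ (+ m - + 1) ℤ.+ t ⊎ InLs (t - + 1) ps y)
  to (suc zero    , _ , y≡) = inj₁ y≡
  to (suc (suc j) , _ , y≡) = inj₂ (suc j , s≤s z≤n , trans y≡ (recharge (+ at ps j) j))
  from : (y ≡ (+ m - + 1) ℤ.+ t ⊎ InLs (t - + 1) ps y) → InLs t (m ∷ ps) y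
  from (inj₁ y≡)                  = 1 , s≤s z≤n , y≡
  from (inj₂ (suc j , _ , y≡)) = suc (suc j) , s≤s z≤n , trans y≡ (sym (recharge (+ at ps j) j))

_≺?_ : ∀ y t → Dec (y ≺ t)
y ≺? t = Dec.map (mk⇔ gap→ →gap) (positive? (t - y))
  where
  positive? : ∀ z → Dec (Σ ℕ λ n → z ≡ + suc n)
  positive? (+ zero)  = no λ { (_ , ()) }
  positive? (+ suc n) = yes (n , refl)
  positive? -[1+ k ]  = no λ { (_ , ()) }
  gap→ : (Σ ℕ λ n → t - y ≡ + suc n) → y ≺ t
  gap→ (n , eq) = n , trans (sym (y+[t-y] y t)) (cong (ℤ._+_ y) eq)
    where
    y+[t-y] : ∀ y t → y ℤ.+ (t - y) ≡ t
    y+[t-y] = ℤ-Solver.solve-∀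
  →gap : y ≺ t → Σ ℕ λ n → t - y ≡ + suc n
  →gap (n , refl) = n , [y+a]-y y (+ suc n)
    where
    [y+a]-y : ∀ y a → y ℤ.+ a - y ≡ a
    [y+a]-y = ℤ-Solver.solve-∀

InLs? : ∀ t ps y → Dec (InLs t ps y)
InLs? t []       y = Dec.map (⇔.sym (InLs-nil t y)) (y ≺? t)
InLs? t (m ∷ ps) y =
  Dec.map (⇔.sym (InLs-cons t m ps y))
          ((y ℤ.≟ (+ m - + 1) ℤ.+ t) ⊎-dec InLs? (t - + 1) ps y)

InLs-shift : ∀ a t ps y → InLs t ps y ⇔ InLs (a ℤ.+ t) ps (a ℤ.+ y)
InLs-shift a t ps y = mk⇔ to from
  where
  to : InLs t ps y → InLs (a ℤ.+ t) ps (a ℤ.+ y)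
  to (j , 1≤j , refl) = j , 1≤j , move a (+ at ps (j ∸ 1) - + j) t
    where
    move : ∀ a x t → a ℤ.+ (x ℤ.+ t) ≡ x ℤ.+ (a ℤ.+ t)
    move = ℤ-Solver.solve-∀
  from : InLs (a ℤ.+ t) ps (a ℤ.+ y) → InLs t ps y
  from (j , 1≤j , eq) = j , 1≤j , trans (sym (cancel a y)) (trans (cong (_- a) eq) (move a (+ at ps (j ∸ 1) - + j) t))
    where
    cancel : ∀ a y → a ℤ.+ y - a ≡ y
    cancel = ℤ-Solver.solve-∀
    move : ∀ a x t → x ℤ.+ (a ℤ.+ t) - a ≡ x ℤ.+ t
    move = ℤ-Solver.solve-∀

InLs-nilℕ : ∀ N k → InLs (+ N) [] (+ k) ⇔ k < N
InLs-nilℕ N k = ⇔.trans (InLs-nil (+ N) (+ k)) (mk⇔ to from)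
  where
  to : + k ≺ + N → k < N
  to (n , eq) = ℕₚ.≤-trans (ℕₚ.m<m+n k {suc n} (s≤s z≤n)) (ℕₚ.≤-reflexive (sym (ℤₚ.+-injective eq)))
  from : k < N → + k ≺ + N
  from k<N = N ∸ suc k , cong +_ (sym (trans (ℕₚ.+-suc k (N ∸ suc k)) (ℕₚ.m+[n∸m]≡n k<N)))

InLs-consℕ : ∀ N m ps k → InLs (+ suc N) (m ∷ ps) (+ k) ⇔ (k ≡ N + m ⊎ InLs (+ N) ps (+ k))
InLs-consℕ N m ps k = ⇔.trans (InLs-cons (+ suc N) m ps (+ k)) (mk⇔ to from)
  where
  top : (+ m - + 1) ℤ.+ + suc N ≡ + (N + m)
  top = trans (regroup (+ m) (+ N)) (sym (ℤₚ.pos-+ N m))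
    where
    regroup : ∀ m N → (m - + 1) ℤ.+ (+ 1 ℤ.+ N) ≡ N ℤ.+ m
    regroup = ℤ-Solver.solve-∀
  to : (+ k ≡ (+ m - + 1) ℤ.+ + suc N ⊎ InLs (+ suc N - + 1) ps (+ k)) → (k ≡ N + m ⊎ InLs (+ N) ps (+ k))
  to (inj₁ eq) = inj₁ (ℤₚ.+-injective (trans eq top))
  to (inj₂ x)  = inj₂ x
  from : (k ≡ N + m ⊎ InLs (+ N) ps (+ k)) → (+ k ≡ (+ m - + 1) ℤ.+ + suc N ⊎ InLs (+ suc N - + 1) ps (+ k))
  from (inj₁ eq) = inj₁ (trans (cong +_ eq) (sym top))
  from (inj₂ x)  = inj₂ x

firstPart : List ℕ → ℕ
firstPart []      = 0
firstPart (m ∷ _) = m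

firstPart-≤ : ∀ {m ps} → Linked ℕ._≥_ (m ∷ ps) → firstPart ps ≤ m
firstPart-≤ [-]       = z≤n
firstPart-≤ (m≥ ∷ _) = m≥

InLs-bounded : ∀ N ps k → Linked ℕ._≥_ ps → length ps ≤ N → InLs (+ N) ps (+ k) → k < N + firstPart ps
InLs-bounded N       []       k _   _            k∈ =
  ℕₚ.≤-trans (Equivalence.to (InLs-nilℕ N k) k∈) (ℕₚ.≤-reflexive (sym (ℕₚ.+-identityʳ N)))
InLs-bounded (suc N) (m ∷ ps) k lnk (s≤s len≤) k∈ with Equivalence.to (InLs-consℕ N m ps k) k∈
... | inj₁ refl = ℕₚ.≤-refl
... | inj₂ k∈′  = ℕₚ.m≤n⇒m≤1+n (ℕₚ.≤-trans (InLs-bounded N ps k (Linked.tail lnk) len≤ k∈′)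
                                           (ℕₚ.+-monoʳ-≤ N (firstPart-≤ lnk)))

-- Bead sums.  The N largest elements of L_N(ps) are N - j + λ_j (1 ≤ j ≤ N); beadSum N ps f adds f
-- over them.
beadSum : ℕ → List ℕ → (ℕ → ℕ) → ℕ
beadSum N       []       f = ∑[ k < N ] f k
beadSum zero    (m ∷ ps) f = 0
beadSum (suc N) (m ∷ ps) f = f (N + m) + beadSum N ps f

beadAt : ℤ → List ℕ → ℤ → ℕ
beadAt t ps y = 𝟙 (InLs? t ps y)

window : ℤ → List ℕ → ℤ → ℕ → (ℕ → ℕ) → ℕ
window t ps A n f = ∑[ k < n ] (beadAt t ps (A ℤ.+ + k) * f k)

private
  window-beads₀ : ∀ N ps n f → Linked ℕ._≥_ ps → length ps ≤ N → N + firstPart ps ≤ n →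
    window (+ N) ps (+ 0) n f ≡ beadSum N ps f
  window-beads₀ N [] n f _ _ N≤n = begin
    ∑[ k < n ] term k                                ≡⟨ cong (λ x → sumBelow x term) (ℕₚ.m+[n∸m]≡n N≤n′) ⟨
    ∑[ k < N + (n ∸ N) ] term k                      ≡⟨ ∑-split N (n ∸ N) term ⟩
    ∑[ k < N ] term k + ∑[ j < n ∸ N ] term (N + j)  ≡⟨ cong₂ _+_ (∑-cong N inside) (∑-vanishes (n ∸ N) _ outside) ⟩
    ∑[ k < N ] f k + 0                               ≡⟨ ℕₚ.+-identityʳ _ ⟩
    ∑[ k < N ] f k ∎
    where
    open ≡-Reasoning
    term : ℕ → ℕ
    term k = beadAt (+ N) [] (+ k) * f k
    N≤n′ : N ≤ n
    N≤n′ = ℕₚ.≤-trans (ℕₚ.m≤m+n N 0) N≤n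
    inside : ∀ k → k < N → term k ≡ f k
    inside k k<N = trans (cong (_* f k) (𝟙-yes (InLs? (+ N) [] (+ k)) (Equivalence.from (InLs-nilℕ N k) k<N)))
                         (ℕₚ.*-identityˡ (f k))
    outside : ∀ j → j < n ∸ N → term (N + j) ≡ 0
    outside j _ = cong (_* f (N + j)) (𝟙-no (InLs? (+ N) [] (+ (N + j))) (λ N+j∈ →
      ℕₚ.<-irrefl refl (ℕₚ.≤-trans (Equivalence.to (InLs-nilℕ N (N + j)) N+j∈) (ℕₚ.m≤m+n N j))))
  window-beads₀ (suc N) (m ∷ ps) n f lnk (s≤s len≤) top≤n = begin
    ∑[ k < n ] term k                  ≡⟨ cong (λ x → sumBelow x term) (ℕₚ.m+[n∸m]≡n top≤n) ⟨
    ∑[ k < suc (N + m) + rest ] term k ≡⟨ ∑-split (suc (N + m)) rest term ⟩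
    ∑[ k < N + m ] term k + term (N + m) + ∑[ j < rest ] term (suc (N + m) + j)
      ≡⟨ cong₃ (λ a b c → a + b + c) (trans (∑-cong (N + m) lower) previous) bead (∑-vanishes rest _ upper) ⟩
    beadSum N ps f + f (N + m) + 0     ≡⟨ trans (ℕₚ.+-identityʳ _) (ℕₚ.+-comm _ (f (N + m))) ⟩
    f (N + m) + beadSum N ps f ∎
    where
    open ≡-Reasoning
    rest = n ∸ suc (N + m)
    term : ℕ → ℕ
    term k = beadAt (+ suc N) (m ∷ ps) (+ k) * f k
    cong₃ : ∀ (g : ℕ → ℕ → ℕ → ℕ) {a a′ b b′ c c′} → a ≡ a′ → b ≡ b′ → c ≡ c′ → g a b c ≡ g a′ b′ c′
    cong₃ g refl refl refl = refl
    -- below the first bead, the beads are those of the remaining rows at charge N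
    lower : ∀ k → k < N + m → term k ≡ beadAt (+ N) ps (+ k) * f k
    lower k k<top = cong (_* f k) (𝟙-cong (InLs? (+ suc N) (m ∷ ps) (+ k)) (InLs? (+ N) ps (+ k))
                                          (⇔.trans (InLs-consℕ N m ps k) (mk⇔ drop inj₂)))
      where
      drop : (k ≡ N + m ⊎ InLs (+ N) ps (+ k)) → InLs (+ N) ps (+ k)
      drop (inj₁ refl) = ⊥-elim (ℕₚ.<-irrefl refl k<top)
      drop (inj₂ k∈)   = k∈
    previous : window (+ N) ps (+ 0) (N + m) f ≡ beadSum N ps f
    previous = window-beads₀ N ps (N + m) f (Linked.tail lnk) len≤ (ℕₚ.+-monoʳ-≤ N (firstPart-≤ lnk))
    bead : term (N + m) ≡ f (N + m)
    bead = trans (cong (_* f (N + m)) (𝟙-yes (InLs? (+ suc N) (m ∷ ps) (+ (N + m)))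
                                             (Equivalence.from (InLs-consℕ N m ps (N + m)) (inj₁ refl))))
                 (ℕₚ.*-identityˡ _)
    upper : ∀ j → j < rest → term (suc (N + m) + j) ≡ 0
    upper j _ = cong (_* f k) (𝟙-no (InLs? (+ suc N) (m ∷ ps) (+ k))
                                    (λ k∈ → above (Equivalence.to (InLs-consℕ N m ps k) k∈)))
      where
      k = suc (N + m) + j
      k≥ : N + m < k
      k≥ = s≤s (ℕₚ.m≤m+n (N + m) j)
      above : (k ≡ N + m ⊎ InLs (+ N) ps (+ k)) → ⊥
      above (inj₁ eq) = ℕₚ.<-irrefl (sym eq) k≥
      above (inj₂ k∈) = ℕₚ.<-asym k≥ (ℕₚ.≤-trans (InLs-bounded N ps k (Linked.tail lnk) len≤ k∈)
                                                (ℕₚ.+-monoʳ-≤ N (firstPart-≤ lnk)))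

window-beads : ∀ A N ps n f → Linked ℕ._≥_ ps → length ps ≤ N → N + firstPart ps ≤ n →
  window (A ℤ.+ + N) ps A n f ≡ beadSum N ps f
window-beads A N ps n f lnk len≤ top≤n = trans (∑-cong n translate) (window-beads₀ N ps n f lnk len≤ top≤n)
  where
  translate : ∀ k → k < n → beadAt (A ℤ.+ + N) ps (A ℤ.+ + k) * f k ≡ beadAt (+ N) ps (+ k) * f k
  translate k _ = cong (_* f k) (𝟙-cong (InLs? (A ℤ.+ + N) ps (A ℤ.+ + k)) (InLs? (+ N) ps (+ k))
                                        (⇔.sym (InLs-shift A (+ N) ps (+ k))))

beadSum-const : ∀ N ps c → beadSum N ps (λ _ → c) ≡ N * c
beadSum-const N       []       c = ∑-const N c
beadSum-const zero    (m ∷ ps) c = refl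
beadSum-const (suc N) (m ∷ ps) c = cong (_+_ c) (beadSum-const N ps c)

beadSum-+ : ∀ N ps (f g : ℕ → ℕ) → beadSum N ps (λ k → f k + g k) ≡ beadSum N ps f + beadSum N ps g
beadSum-+ N       []       f g = ∑-+ N f g
beadSum-+ zero    (m ∷ ps) f g = refl
beadSum-+ (suc N) (m ∷ ps) f g =
  trans (cong (_+_ (f (N + m) + g (N + m))) (beadSum-+ N ps f g))
        (interchange (f (N + m)) (g (N + m)) (beadSum N ps f) (beadSum N ps g))

beadSum-*ˡ : ∀ N ps a (f : ℕ → ℕ) → beadSum N ps (λ k → a * f k) ≡ a * beadSum N ps f
beadSum-*ˡ N       []       a f = ∑-*ˡ N a f
beadSum-*ˡ zero    (m ∷ ps) a f = sym (ℕₚ.*-zeroʳ a)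
beadSum-*ˡ (suc N) (m ∷ ps) a f =
  trans (cong (_+_ (a * f (N + m))) (beadSum-*ˡ N ps a f)) (sym (ℕₚ.*-distribˡ-+ a _ _))

-- Moving the bead of row a from its empty position N - a to N - a + λ_a
-- passes over one node of each residue met on the way, so with G_i = resCount e i:
--   c_i(λ) + ∑_{k<N} G_i(k) = ∑_{beads b} G_i(b).
module _ (e : ℕ) .{{_ : NonZero e}} where

  private
    row-residues : ∀ Q N a i m → countRow e (Q ℤ.* + e ℤ.+ + (suc N + a)) (suc a) m i
                               ≡ ∑[ j < m ] 𝟙 ((suc N + j) % e ℕ.≟ i)
    row-residues Q N a i zero    = refl
    row-residues Q N a i (suc m) = cong₂ _+_ (row-residues Q N a i m) (cong (λ x → 𝟙 (x ℕ.≟ i)) residue≡)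
      where
      node : (+ suc m - + suc a) ℤ.+ (Q ℤ.* + e ℤ.+ + (suc N + a)) ≡ Q ℤ.* + e ℤ.+ + (suc N + m)
      node = begin
        (+ suc m - + suc a) ℤ.+ (Q ℤ.* + e ℤ.+ + (suc N + a))
          ≡⟨ cong (λ z → (+ suc m - + suc a) ℤ.+ (Q ℤ.* + e ℤ.+ z)) (ℤₚ.pos-+ (suc N) a) ⟩
        (+ 1 ℤ.+ + m - (+ 1 ℤ.+ + a)) ℤ.+ (Q ℤ.* + e ℤ.+ (+ suc N ℤ.+ + a))
          ≡⟨ regroup (+ m) (+ a) (Q ℤ.* + e) (+ suc N) ⟩
        Q ℤ.* + e ℤ.+ (+ suc N ℤ.+ + m)
          ≡⟨ cong (ℤ._+_ (Q ℤ.* + e)) (sym (ℤₚ.pos-+ (suc N) m)) ⟩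
        Q ℤ.* + e ℤ.+ + (suc N + m) ∎
        where
        open ≡-Reasoning
        regroup : ∀ m a A N → (+ 1 ℤ.+ m - (+ 1 ℤ.+ a)) ℤ.+ (A ℤ.+ (N ℤ.+ a)) ≡ A ℤ.+ (N ℤ.+ m)
        regroup = ℤ-Solver.solve-∀
      residue≡ : residue e (Q ℤ.* + e ℤ.+ + (suc N + a)) (suc a) (suc m) ≡ (suc N + m) % e
      residue≡ = trans (cong (_%ℕ e) node) (%ℕ-shift e Q (suc N + m))

    resCount-extend : ∀ i N m → resCount e i (N + m) ≡ resCount e i N + ∑[ j < m ] 𝟙 ((suc N + j) % e ℕ.≟ i)
    resCount-extend i N m = ∑-split (suc N) m (λ j → 𝟙 (j % e ℕ.≟ i))

    content-beads′ : ∀ i Q ps N a → length ps ≤ N →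
      countRows e (Q ℤ.* + e ℤ.+ + (N + a)) (suc a) ps i + ∑[ k < N ] resCount e i k ≡ beadSum N ps (resCount e i)
    content-beads′ i Q []       N       a _          = refl
    content-beads′ i Q (m ∷ ps) (suc N) a (s≤s len≤) = begin
      (R + Rs) + (∑[ k < N ] G k + G N)   ≡⟨ interchange′ R Rs (∑[ k < N ] G k) (G N) ⟩
      (G N + R) + (Rs + ∑[ k < N ] G k)   ≡⟨ cong₂ _+_ first-row other-rows ⟩
      G (N + m) + beadSum N ps G ∎
      where
      open ≡-Reasoning
      G = resCount e i
      R  = countRow e (Q ℤ.* + e ℤ.+ + (suc N + a)) (suc a) m i
      Rs = countRows e (Q ℤ.* + e ℤ.+ + (suc N + a)) (suc (suc a)) ps i
      interchange′ : ∀ a b c d → (a + b) + (c + d) ≡ (d + a) + (b + c)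
      interchange′ = solve-∀
      first-row : G N + R ≡ G (N + m)
      first-row = trans (cong (_+_ (G N)) (row-residues Q N a i m)) (sym (resCount-extend i N m))
      other-rows : Rs + ∑[ k < N ] G k ≡ beadSum N ps G
      other-rows = trans (cong (λ n → countRows e (Q ℤ.* + e ℤ.+ + n) (suc (suc a)) ps i + ∑[ k < N ] G k)
                               (sym (ℕₚ.+-suc N a)))
                         (content-beads′ i Q ps N (suc a) len≤)

  content-beads : ∀ i Q N λp → length (parts λp) ≤ N →
    contentCount e (Q ℤ.* + e ℤ.+ + N) λp i + ∑[ k < N ] resCount e i k ≡ beadSum N (parts λp) (resCount e i)
  content-beads i Q N λp len≤ =
    trans (cong (λ n → countRows e (Q ℤ.* + e ℤ.+ + n) 1 (parts λp) i + ∑[ k < N ] resCount e i k)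
                (sym (ℕₚ.+-identityʳ N)))
          (content-beads′ i Q (parts λp) N 0 len≤)

  content-beads-shifted : ∀ a i Q N λp → length (parts λp) ≤ N →
    contentCount e (Q ℤ.* + e ℤ.+ + N) λp i + (∑[ k < N ] resCount e i k + N * a)
      ≡ beadSum N (parts λp) (λ k → resCount e i k + a)
  content-beads-shifted a i Q N λp len≤ = begin
    C + (∑[ k < N ] resCount e i k + N * a)
      ≡⟨ ℕₚ.+-assoc C _ _ ⟨
    C + ∑[ k < N ] resCount e i k + N * a
      ≡⟨ cong₂ _+_ (content-beads i Q N λp len≤) (sym (beadSum-const N (parts λp) a)) ⟩
    beadSum N (parts λp) (resCount e i) + beadSum N (parts λp) (λ _ → a)
      ≡⟨ beadSum-+ N (parts λp) (resCount e i) (λ _ → a) ⟨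
    beadSum N (parts λp) (λ k → resCount e i k + a) ∎
    where
    open ≡-Reasoning
    C = contentCount e (Q ℤ.* + e ℤ.+ + N) λp i

  content-beads-combined : ∀ a d i Q N λp → length (parts λp) ≤ N →
    let C = λ j → contentCount e (Q ℤ.* + e ℤ.+ + N) λp j in
    beadSum N (parts λp) (λ κ → a * resCount e 0 κ + resCount e i κ + d)
      ≡ (a * C 0 + C i) + (a * ∑[ k < N ] resCount e 0 k + ∑[ k < N ] resCount e i k + N * d)
  content-beads-combined a d i Q N λp len≤ = begin
    beadSum N ps (λ κ → a * G 0 κ + G i κ + d)
      ≡⟨ beadSum-+ N ps (λ κ → a * G 0 κ + G i κ) (λ _ → d) ⟩
    beadSum N ps (λ κ → a * G 0 κ + G i κ) + beadSum N ps (λ _ → d)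
      ≡⟨ cong₂ _+_ (trans (beadSum-+ N ps (λ κ → a * G 0 κ) (G i))
                          (cong (_+ beadSum N ps (G i)) (beadSum-*ˡ N ps a (G 0))))
                   (beadSum-const N ps d) ⟩
    a * beadSum N ps (G 0) + beadSum N ps (G i) + N * d
      ≡⟨ cong₂ (λ x y → a * x + y + N * d) (sym (content-beads 0 Q N λp len≤)) (sym (content-beads i Q N λp len≤)) ⟩
    a * (C 0 + ∑[ k < N ] G 0 k) + (C i + ∑[ k < N ] G i k) + N * d
      ≡⟨ regroup a (C 0) (∑[ k < N ] G 0 k) (C i) (∑[ k < N ] G i k) (N * d) ⟩
    (a * C 0 + C i) + (a * ∑[ k < N ] G 0 k + ∑[ k < N ] G i k + N * d) ∎
    where
    open ≡-Reasoning
    G = resCount e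
    ps = parts λp
    C = λ j → contentCount e (Q ℤ.* + e ℤ.+ + N) λp j
    regroup : ∀ a x y x′ y′ z → a * (x + y) + (x′ + y′) + z ≡ (a * x + x′) + (a * y + y′ + z)
    regroup = solve-∀

-- The Uglov abacus.  Component c ∈ Fin l (the paper's c = toℕ c + 1) occupies, inside each period
-- of length e l, the block of e positions starting at (l - c) e.
offset : (l : ℕ) → Fin l → ℕ
offset l c = l ∸ suc (toℕ c)

module _ (e : ℕ) .{{_ : NonZero e}} (l : ℕ) .{{_ : NonZero l}} (s : Vec ℤ l) (λs : MultiPartition l) where

  UglovImage : ℤ → Partition → Set
  UglovImage t T = ∀ k → InL t T k ⇔ UglovSet e l s λs k

  WeightsMatch : (ℕ → ℕ) → (Fin l → ℕ → ℕ) → Set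
  WeightsMatch fτ f = ∀ c q r → r < e → fτ (q * (e * l) + (offset l c * e + r)) ≡ f c (q * e + r)

  private
    instance
      el≢0 : NonZero (e * l)
      el≢0 = ℕₚ.m*n≢0 e l

    offset-injective : ∀ c c′ → offset l c ≡ offset l c′ → c ≡ c′
    offset-injective c c′ eq = toℕ-injective (ℕₚ.suc-injective (ℕₚ.∸-cancelˡ-≡ (toℕ<n c) (toℕ<n c′) eq))

    in-period : ∀ c r → r < e → offset l c * e + r < e * l
    in-period c r r<e = begin-strict
      offset l c * e + r   <⟨ ℕₚ.+-monoʳ-< (offset l c * e) r<e ⟩
      offset l c * e + e   ≡⟨ ℕₚ.+-comm (offset l c * e) e ⟩
      suc (offset l c) * e ≤⟨ ℕₚ.*-monoˡ-≤ e (ℕₚ.∸-monoʳ-< {l} {suc (toℕ c)} {0} (s≤s z≤n) (toℕ<n c)) ⟩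
      l * e                ≡⟨ ℕₚ.*-comm l e ⟩
      e * l                ∎
      where open ℕₚ.≤-Reasoning

    abacus-position : ∀ c Q r →
      + (offset l c * e) ℤ.+ Q ℤ.* + (e * l) ℤ.+ + r ≡ + (offset l c * e + r) ℤ.+ Q ℤ.* + (e * l)
    abacus-position c Q r = trans (swap (+ (offset l c * e)) (Q ℤ.* + (e * l)) (+ r))
                                  (cong (ℤ._+ Q ℤ.* + (e * l)) (sym (ℤₚ.pos-+ (offset l c * e) r)))
      where
      swap : ∀ a b c → a ℤ.+ b ℤ.+ c ≡ a ℤ.+ c ℤ.+ b
      swap = ℤ-Solver.solve-∀

    in-period-of : ∀ P q E x → P ℤ.* + E ℤ.+ + (q * E + x) ≡ + x ℤ.+ (P ℤ.+ + q) ℤ.* + E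
    in-period-of P q E x = trans (cong (ℤ._+_ (P ℤ.* + E)) (trans (ℤₚ.pos-+ (q * E) x) (cong (ℤ._+ + x) (ℤₚ.pos-* q E))))
                                 (regroup P (+ q) (+ E) (+ x))
      where
      regroup : ∀ P q E x → P ℤ.* E ℤ.+ (q ℤ.* E ℤ.+ x) ≡ x ℤ.+ (P ℤ.+ q) ℤ.* E
      regroup = ℤ-Solver.solve-∀

  UglovSet-block : ∀ c r Q → r < e →
    UglovSet e l s λs (+ (offset l c * e + r) ℤ.+ Q ℤ.* + (e * l)) ⇔ InL (lookup s c) (lookup λs c) (+ r ℤ.+ Q ℤ.* + e)
  UglovSet-block c r Q r<e = mk⇔ to from
    where
    y = + (offset l c * e + r) ℤ.+ Q ℤ.* + (e * l)
    k = + r ℤ.+ Q ℤ.* + e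
    y÷el = divMod-unique y (e * l) (offset l c * e + r) Q (in-period c r r<e) refl
    k÷e = divMod-unique k e r Q r<e refl
    from : InL (lookup s c) (lookup λs c) k → UglovSet e l s λs y
    from k∈ = c , k , k∈ , sym (trans (abacus-position c (k /ℕ e) (k %ℕ e))
                                      (cong₂ (λ r′ Q′ → + (offset l c * e + r′) ℤ.+ Q′ ℤ.* + (e * l))
                                             (proj₁ k÷e) (proj₂ k÷e)))
    to : UglovSet e l s λs y → InL (lookup s c) (lookup λs c) k
    to (c′ , k′ , k′∈ , y≡) =
      subst (λ c″ → InL (lookup s c″) (lookup λs c″) k) c′≡c
            (subst (InL (lookup s c′) (lookup λs c′)) k′≡k k′∈)
      where
      r′ = k′ %ℕ e
      Q′ = k′ /ℕ e
      -- dividing y by e l in two ways gives the same block and the same period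
      y÷el′ = divMod-unique y (e * l) (offset l c′ * e + r′) Q′ (in-period c′ r′ (n%ℕd<d k′ e))
                            (trans y≡ (abacus-position c′ Q′ r′))
      digits = digits-unique e (offset l c) r (offset l c′) r′ r<e (n%ℕd<d k′ e)
                             (trans (sym (proj₁ y÷el)) (proj₁ y÷el′))
      c′≡c : c′ ≡ c
      c′≡c = offset-injective c′ c (sym (proj₁ digits))
      k′≡k : k′ ≡ k
      k′≡k = trans (a≡a%ℕn+[a/ℕn]*n k′ e)
                   (cong₂ (λ r″ Q″ → + r″ ℤ.+ Q″ ℤ.* + e)
                          (sym (proj₂ digits)) (trans (sym (proj₂ y÷el′)) (proj₂ y÷el)))

  uglov-window : ∀ t T → UglovImage t T → ∀ P Nq fτ f → WeightsMatch fτ f →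
    window t (parts T) (P ℤ.* + (e * l)) (Nq * (e * l)) fτ
      ≡ sumFin l (λ c → window (lookup s c) (parts (lookup λs c)) (P ℤ.* + e) (Nq * e) (f c))
  uglov-window t T T≡U P Nq fτ f f≡ = begin
    ∑[ k < Nq * (e * l) ] h k
      ≡⟨ ∑-blocks Nq (e * l) h ⟩
    ∑[ q < Nq ] ∑[ j < e * l ] h (q * (e * l) + j)
      ≡⟨ ∑-cong Nq (λ q _ → trans (cong (λ n → sumBelow n (λ j → h (q * (e * l) + j))) (ℕₚ.*-comm e l))
                                  (∑-blocks l e (λ j → h (q * (e * l) + j)))) ⟩
    ∑[ q < Nq ] ∑[ d < l ] ∑[ r < e ] h (q * (e * l) + (d * e + r))
      ≡⟨ ∑-swap Nq l (λ q d → ∑[ r < e ] h (q * (e * l) + (d * e + r))) ⟩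
    ∑[ d < l ] ∑[ q < Nq ] ∑[ r < e ] h (q * (e * l) + (d * e + r))
      ≡⟨ sumFin-reverse l (λ d → ∑[ q < Nq ] ∑[ r < e ] h (q * (e * l) + (d * e + r))) ⟩
    sumFin l (λ c → ∑[ q < Nq ] ∑[ r < e ] h (q * (e * l) + (offset l c * e + r)))
      ≡⟨ sumFin-cong l (λ c → ∑-cong Nq (λ q _ → ∑-cong e (λ r r<e → blockwise c q r r<e))) ⟩
    sumFin l (λ c → ∑[ q < Nq ] ∑[ r < e ] hc c (q * e + r))
      ≡⟨ sumFin-cong l (λ c → sym (∑-blocks Nq e (hc c))) ⟩
    sumFin l (λ c → ∑[ κ < Nq * e ] hc c κ) ∎
    where
    open ≡-Reasoning
    h : ℕ → ℕ
    h k = beadAt t (parts T) (P ℤ.* + (e * l) ℤ.+ + k) * fτ k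
    hc : Fin l → ℕ → ℕ
    hc c κ = beadAt (lookup s c) (parts (lookup λs c)) (P ℤ.* + e ℤ.+ + κ) * f c κ
    blockwise : ∀ c q r → r < e → h (q * (e * l) + (offset l c * e + r)) ≡ hc c (q * e + r)
    blockwise c q r r<e = cong₂ _*_ (𝟙-cong (InLs? t (parts T) y) (InLs? (lookup s c) (parts (lookup λs c)) κ) member)
                                    (f≡ c q r r<e)
      where
      y = P ℤ.* + (e * l) ℤ.+ + (q * (e * l) + (offset l c * e + r))
      κ = P ℤ.* + e ℤ.+ + (q * e + r)
      member : InLs t (parts T) y ⇔ InLs (lookup s c) (parts (lookup λs c)) κ
      member = subst₂ _⇔_ (cong (InLs t (parts T)) (sym (in-period-of P q (e * l) (offset l c * e + r))))
                          (cong (InLs (lookup s c) (parts (lookup λs c))) (sym (in-period-of P q e r)))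
                          (⇔.trans (T≡U _) (UglovSet-block c r (P ℤ.+ + q) r<e))

  uglov-beads : ∀ t T → UglovImage t T → ∀ P Nτ (N : Fin l → ℕ) →
    t ≡ P ℤ.* + (e * l) ℤ.+ + Nτ → length (parts T) ≤ Nτ →
    (∀ c → lookup s c ≡ P ℤ.* + e ℤ.+ + N c) → (∀ c → length (parts (lookup λs c)) ≤ N c) →
    ∀ fτ f → WeightsMatch fτ f →
    beadSum Nτ (parts T) fτ ≡ sumFin l (λ c → beadSum (N c) (parts (lookup λs c)) (f c))
  uglov-beads t T T≡U P Nτ N refl lenτ s≡ lenc fτ f f≡ = begin
    beadSum Nτ (parts T) fτ
      ≡⟨ window-beads (P ℤ.* + (e * l)) Nτ (parts T) (Nq * (e * l)) fτ (nonincr T) lenτ reachesτ ⟨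
    window t (parts T) (P ℤ.* + (e * l)) (Nq * (e * l)) fτ
      ≡⟨ uglov-window t T T≡U P Nq fτ f f≡ ⟩
    sumFin l (λ c → window (lookup s c) (rows c) (P ℤ.* + e) (Nq * e) (f c))
      ≡⟨ sumFin-cong l component ⟩
    sumFin l (λ c → beadSum (N c) (rows c) (f c)) ∎
    where
    open ≡-Reasoning
    rows : Fin l → List ℕ
    rows c = parts (lookup λs c)
    -- a number of periods large enough for every window to contain all beads
    Nq = (Nτ + firstPart (parts T)) + sumFin l (λ c → N c + firstPart (rows c))
    reachesτ : Nτ + firstPart (parts T) ≤ Nq * (e * l)
    reachesτ = ℕₚ.≤-trans (ℕₚ.m≤m+n _ _) (ℕₚ.m≤m*n Nq (e * l))
    reaches : ∀ c → N c + firstPart (rows c) ≤ Nq * e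
    reaches c = ℕₚ.≤-trans (sumFin-≤ l (λ c → N c + firstPart (rows c)) c)
                           (ℕₚ.≤-trans (ℕₚ.m≤n+m _ _) (ℕₚ.m≤m*n Nq e))
    component : ∀ c → window (lookup s c) (rows c) (P ℤ.* + e) (Nq * e) (f c) ≡ beadSum (N c) (rows c) (f c)
    component c = trans (cong (λ t → window t (rows c) (P ℤ.* + e) (Nq * e) (f c)) (s≡ c))
                        (window-beads (P ℤ.* + e) (N c) (rows c) (Nq * e) (f c) (nonincr (lookup λs c)) (lenc c) (reaches c))

private
  nonneg-shift : ∀ x M L → ∣ x ∣ + L ≤ M → Σ ℕ λ N → (x ℤ.+ + M ≡ + N) × (L ≤ N)
  nonneg-shift (+ a)    M L h = a + M , sym (ℤₚ.pos-+ a M) ,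
    ℕₚ.≤-trans (ℕₚ.≤-trans (ℕₚ.m≤n+m L a) h) (ℕₚ.m≤n+m M a)
  nonneg-shift -[1+ a ] M L h = M ∸ suc a , ℤₚ.⊖-≥ (ℕₚ.≤-trans (ℕₚ.m≤m+n (suc a) L) h) ,
    ℕₚ.≤-trans (ℕₚ.≤-reflexive (sym (ℕₚ.m+n∸m≡n (suc a) L))) (ℕₚ.∸-monoˡ-≤ (suc a) h)

heightAbove : ℕ → ℤ → ℕ
heightAbove M x = ∣ x ℤ.+ + M ∣

above-origin : ∀ x B E L → ∣ x ∣ + L ≤ B * E →
  (x ≡ (- + B) ℤ.* + E ℤ.+ + heightAbove (B * E) x) × (L ≤ heightAbove (B * E) x)
above-origin x B E L bound with nonneg-shift x (B * E) L bound
... | N , x+BE≡N , L≤N = x≡ , ℕₚ.≤-trans L≤N (ℕₚ.≤-reflexive (cong ∣_∣ (sym x+BE≡N)))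
  where
  undo : ∀ x B E → x ≡ (- B) ℤ.* E ℤ.+ (x ℤ.+ B ℤ.* E)
  undo = ℤ-Solver.solve-∀
  x≡ : x ≡ (- + B) ℤ.* + E ℤ.+ + heightAbove (B * E) x
  x≡ = trans (undo x (+ B) (+ E))
             (cong (λ z → (- + B) ℤ.* + E ℤ.+ z)
                   (trans (cong (ℤ._+_ x) (sym (ℤₚ.pos-* B E))) (trans x+BE≡N (cong (λ z → + ∣ z ∣) (sym x+BE≡N)))))

sumℤ-offsets : ∀ l (s : Vec ℤ l) A (N : Fin l → ℕ) → (∀ c → lookup s c ≡ A ℤ.+ + N c) →
  sumℤ l s ≡ + l ℤ.* A ℤ.+ + sumFin l N
sumℤ-offsets zero    []       A N _  = sym (zero-* A)
  where
  zero-* : ∀ A → + 0 ℤ.* A ℤ.+ + 0 ≡ + 0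
  zero-* = ℤ-Solver.solve-∀
sumℤ-offsets (suc l) (x ∷ xs) A N s≡ = begin
  x ℤ.+ sumℤ l xs
    ≡⟨ cong₂ ℤ._+_ (s≡ Fin.zero) (sumℤ-offsets l xs A (λ c → N (Fin.suc c)) (λ c → s≡ (Fin.suc c))) ⟩
  A ℤ.+ + N Fin.zero ℤ.+ (+ l ℤ.* A ℤ.+ + sumFin l (λ c → N (Fin.suc c)))
    ≡⟨ regroup A (+ N Fin.zero) (+ l) (+ sumFin l (λ c → N (Fin.suc c))) ⟩
  (+ 1 ℤ.+ + l) ℤ.* A ℤ.+ (+ N Fin.zero ℤ.+ + sumFin l (λ c → N (Fin.suc c)))
    ≡⟨ cong (λ z → (+ 1 ℤ.+ + l) ℤ.* A ℤ.+ z) (sym (ℤₚ.pos-+ (N Fin.zero) _)) ⟩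
  + suc l ℤ.* A ℤ.+ + sumFin (suc l) N ∎
  where
  open ≡-Reasoning
  regroup : ∀ A n l m → A ℤ.+ n ℤ.+ (l ℤ.* A ℤ.+ m) ≡ (+ 1 ℤ.+ l) ℤ.* A ℤ.+ (n ℤ.+ m)
  regroup = ℤ-Solver.solve-∀

resCount-weights : ∀ e .{{_ : NonZero e}} l′ i d q r → i < e → r < e →
  resCount e i (q * (e * suc l′) + (d * e + r)) + l′ ≡ l′ * resCount e 0 (q * e + r) + resCount e i (q * e + r) + d
resCount-weights e l′ i d q r i<e r<e = begin
  resCount e i (q * (e * suc l′) + (d * e + r)) + l′
    ≡⟨ cong (λ K → resCount e i K + l′) (digits q (suc l′) e d r) ⟩
  resCount e i ((q * suc l′ + d) * e + r) + l′
    ≡⟨ cong (_+ l′) (resCount-formula e i (q * suc l′ + d) r i<e r<e) ⟩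
  q * suc l′ + d + β + l′
    ≡⟨ regroup q l′ d β ⟩
  l′ * (q + 1) + (q + β) + d
    ≡⟨ cong₂ (λ a b → l′ * a + b + d) (cong (_+_ q) (sym (∑-𝟙-point (suc r) 0 (s≤s z≤n)))) refl ⟩
  l′ * (q + ∑[ j < suc r ] 𝟙 (j ℕ.≟ 0)) + (q + β) + d
    ≡⟨ cong₂ (λ a b → l′ * a + b + d) (sym (resCount-formula e 0 q r (ℕₚ.≤-<-trans z≤n i<e) r<e))
                                       (sym (resCount-formula e i q r i<e r<e)) ⟩
  l′ * resCount e 0 (q * e + r) + resCount e i (q * e + r) + d ∎
  where
  open ≡-Reasoning
  β = ∑[ j < suc r ] 𝟙 (j ℕ.≟ i)
  digits : ∀ q l e d r → q * (e * l) + (d * e + r) ≡ (q * l + d) * e + r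
  digits = solve-∀
  regroup : ∀ q l′ d β → q * suc l′ + d + β + l′ ≡ l′ * (q + 1) + (q + β) + d
  regroup = solve-∀

-- Every abacus is read from an
-- origin B periods below 0; for B large the identity holds with correction terms depending on s and
-- B only.
module _ (e : ℕ) .{{_ : NonZero e}} (l′ : ℕ) (s : Vec ℤ (suc l′)) where

  private
    l = suc l′

    instance
      el≢0 : NonZero (e * l)
      el≢0 = ℕₚ.m*n≢0 e l

  -- B is large when the origin lies below every charge and leaves room for every row.
  uglovBound : MultiPartition l → ℤ → Partition → ℕ
  uglovBound λs t T =
    sumFin l (λ c → ∣ lookup s c ∣ + length (parts (lookup λs c))) + (∣ t ∣ + length (parts T))

  Nc : ℕ → Fin l → ℕ
  Nc B c = heightAbove (B * e) (lookup s c)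

  charge-above : ∀ λs t T B → uglovBound λs t T ≤ B →
    (t ≡ (- + B) ℤ.* + (e * l) ℤ.+ + heightAbove (B * (e * l)) t)
    × (length (parts T) ≤ heightAbove (B * (e * l)) t)
  charge-above λs t T B B₀≤B = above-origin t B (e * l) (length (parts T))
    (ℕₚ.≤-trans (ℕₚ.≤-trans (ℕₚ.m≤n+m _ (sumFin l (λ c → ∣ lookup s c ∣ + length (parts (lookup λs c))))) B₀≤B)
                (ℕₚ.m≤m*n B (e * l)))

  charges-above : ∀ λs t T B → uglovBound λs t T ≤ B → ∀ c →
    (lookup s c ≡ (- + B) ℤ.* + e ℤ.+ + Nc B c) × (length (parts (lookup λs c)) ≤ Nc B c)
  charges-above λs t T B B₀≤B c = above-origin (lookup s c) B e (length (parts (lookup λs c)))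
    (ℕₚ.≤-trans (ℕₚ.≤-trans (sumFin-≤ l (λ c → ∣ lookup s c ∣ + length (parts (lookup λs c))) c)
                            (ℕₚ.≤-trans (ℕₚ.m≤m+n _ _) B₀≤B))
                (ℕₚ.m≤m*n B e))

  uglov-beads-at : ∀ λs t T → UglovImage e l s λs t T → ∀ B → uglovBound λs t T ≤ B →
    ∀ fτ f → WeightsMatch e l s λs fτ f →
    beadSum (heightAbove (B * (e * l)) t) (parts T) fτ ≡ sumFin l (λ c → beadSum (Nc B c) (parts (lookup λs c)) (f c))
  uglov-beads-at λs t T img B B₀≤B =
    uglov-beads e l s λs t T img (- + B) (heightAbove (B * (e * l)) t) (Nc B)
      (proj₁ τ-above) (proj₂ τ-above) (λ c → proj₁ (c-above c)) (λ c → proj₂ (c-above c))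
    where
    τ-above = charge-above λs t T B B₀≤B
    c-above = charges-above λs t T B B₀≤B

  uglov-charge : ∀ λs t T → UglovImage e l s λs t T → t ≡ sumℤ l s
  uglov-charge λs t T img = begin
    t                                               ≡⟨ proj₁ (charge-above λs t T B ℕₚ.≤-refl) ⟩
    (- + B) ℤ.* + (e * l) ℤ.+ + Nτ                  ≡⟨ cong₂ (λ a b → a ℤ.+ + b) periods beads ⟩
    + l ℤ.* ((- + B) ℤ.* + e) ℤ.+ + sumFin l (Nc B) ≡⟨ sumℤ-offsets l s ((- + B) ℤ.* + e) (Nc B) charges ⟨
    sumℤ l s ∎
    where
    open ≡-Reasoning
    B = uglovBound λs t T
    Nτ = heightAbove (B * (e * l)) t
    charges : ∀ c → lookup s c ≡ (- + B) ℤ.* + e ℤ.+ + Nc B c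
    charges c = proj₁ (charges-above λs t T B ℕₚ.≤-refl c)
    -- each of the Nτ beads of T comes from exactly one bead of a component
    beads : Nτ ≡ sumFin l (Nc B)
    beads = begin
      Nτ                                    ≡⟨ ℕₚ.*-identityʳ Nτ ⟨
      Nτ * 1                                ≡⟨ beadSum-const Nτ (parts T) 1 ⟨
      beadSum Nτ (parts T) (λ _ → 1)
        ≡⟨ uglov-beads-at λs t T img B ℕₚ.≤-refl (λ _ → 1) (λ _ _ → 1) (λ _ _ _ _ → refl) ⟩
      sumFin l (λ c → beadSum (Nc B c) (parts (lookup λs c)) (λ _ → 1))
        ≡⟨ sumFin-cong l (λ c → trans (beadSum-const (Nc B c) (parts (lookup λs c)) 1) (ℕₚ.*-identityʳ (Nc B c))) ⟩
      sumFin l (Nc B) ∎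
    periods : (- + B) ℤ.* + (e * l) ≡ + l ℤ.* ((- + B) ℤ.* + e)
    periods = trans (cong ((- + B) ℤ.*_) (ℤₚ.pos-* e l)) (regroup (- + B) (+ e) (+ l))
      where
      regroup : ∀ P e l → P ℤ.* (e ℤ.* l) ≡ l ℤ.* (P ℤ.* e)
      regroup = ℤ-Solver.solve-∀

  Nτ : ℕ → ℕ
  Nτ B = heightAbove (B * (e * l)) (sumℤ l s)

  uglovVacuum : ℕ → ℕ → ℕ
  uglovVacuum B i = ∑[ k < Nτ B ] resCount e i k + Nτ B * l′

  componentVacuum : ℕ → ℕ → ℕ
  componentVacuum B i =
    sumFin l (λ c → l′ * ∑[ k < Nc B c ] resCount e 0 k + ∑[ k < Nc B c ] resCount e i k + Nc B c * offset l c)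

  uglov-content-identity : ∀ λs t T → UglovImage e l s λs t T → ∀ B → uglovBound λs t T ≤ B → ∀ i → i < e →
    contentCount e (sumℤ l s) T i + uglovVacuum B i
      ≡ l′ * multiContentCount e l s λs 0 + multiContentCount e l s λs i + componentVacuum B i
  uglov-content-identity λs t T img B B₀≤B i i<e with uglov-charge λs t T img
  ... | refl = begin
    contentCount e (sumℤ l s) T i + uglovVacuum B i
      ≡⟨ cong (λ t′ → contentCount e t′ T i + uglovVacuum B i) τ-charge ⟩
    contentCount e ((- + B ℤ.* + l) ℤ.* + e ℤ.+ + Nτ B) T i + uglovVacuum B i
      ≡⟨ content-beads-shifted e l′ i (- + B ℤ.* + l) (Nτ B) T (proj₂ τ-above) ⟩
    beadSum (Nτ B) (parts T) (λ k → resCount e i k + l′)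
      ≡⟨ uglov-beads-at λs t T img B B₀≤B (λ k → resCount e i k + l′) f
                        (λ c q r r<e → resCount-weights e l′ i (offset l c) q r i<e r<e) ⟩
    sumFin l (λ c → beadSum (Nc B c) (parts (lookup λs c)) (f c))
      ≡⟨ sumFin-cong l component ⟩
    sumFin l (λ c → (l′ * content c 0 + content c i) + vacuum c)
      ≡⟨ sumFin-affine l l′ (λ c → content c 0) (λ c → content c i) vacuum ⟩
    l′ * multiContentCount e l s λs 0 + multiContentCount e l s λs i + componentVacuum B i ∎
    where
    open ≡-Reasoning
    f : Fin l → ℕ → ℕ
    f c κ = l′ * resCount e 0 κ + resCount e i κ + offset l c
    content : Fin l → ℕ → ℕ
    content c j = contentCount e (lookup s c) (lookup λs c) j
    vacuum : Fin l → ℕ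
    vacuum c = l′ * ∑[ k < Nc B c ] resCount e 0 k + ∑[ k < Nc B c ] resCount e i k + Nc B c * offset l c
    τ-above = charge-above λs t T B B₀≤B
    τ-charge : sumℤ l s ≡ (- + B ℤ.* + l) ℤ.* + e ℤ.+ + Nτ B
    τ-charge = trans (proj₁ τ-above)
                     (cong (ℤ._+ + Nτ B) (trans (cong (- + B ℤ.*_) (ℤₚ.pos-* e l)) (regroup (- + B) (+ e) (+ l))))
      where
      regroup : ∀ P e l → P ℤ.* (e ℤ.* l) ≡ P ℤ.* l ℤ.* e
      regroup = ℤ-Solver.solve-∀
    component : ∀ c → beadSum (Nc B c) (parts (lookup λs c)) (f c) ≡ (l′ * content c 0 + content c i) + vacuum c
    component c = trans (content-beads-combined e l′ (offset l c) i (- + B) (Nc B c) (lookup λs c) (proj₂ c-above))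
                        (cong (λ t′ → (l′ * contentCount e t′ λc 0 + contentCount e t′ λc i) + vacuum c)
                              (sym (proj₁ c-above)))
      where
      λc = lookup λs c
      c-above = charges-above λs t T B B₀≤B c

tabulate-≡ : ∀ {n} (f g : Fin n → ℕ) → tabulate f ≡ tabulate g ⇔ (∀ i → f i ≡ g i)
tabulate-≡ f g = mk⇔ entries tabulate-cong
  where
  entries : tabulate f ≡ tabulate g → ∀ i → f i ≡ g i
  entries eq i = trans (sym (lookup∘tabulate f i)) (trans (cong (λ v → lookup v i) eq) (lookup∘tabulate g i))

-- If C_i + X_i = a m_0 + m_i + K_i for two families (C, m) and (C′, m′) with the same X, K and a,
-- then C and C′ agree iff m and m′ agree: the entry i = 0 recovers m_0, and then every m_i.
affine-determines : ∀ {n} a (X K C C′ m m′ : Fin (suc n) → ℕ) →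
  (∀ i → C i + X i ≡ a * m Fin.zero + m i + K i) → (∀ i → C′ i + X i ≡ a * m′ Fin.zero + m′ i + K i) →
  (∀ i → C i ≡ C′ i) ⇔ (∀ i → m i ≡ m′ i)
affine-determines a X K C C′ m m′ eq eq′ = mk⇔ to from
  where
  to : (∀ i → C i ≡ C′ i) → ∀ i → m i ≡ m′ i
  to C≡ i = ℕₚ.+-cancelˡ-≡ (a * m Fin.zero) (m i) (m′ i)
              (trans (ℕₚ.+-cancelʳ-≡ (K i) _ _ (same i)) (cong (λ x → a * x + m′ i) (sym m₀≡)))
    where
    same : ∀ i → a * m Fin.zero + m i + K i ≡ a * m′ Fin.zero + m′ i + K i
    same i = trans (sym (eq i)) (trans (cong (_+ X i) (C≡ i)) (eq′ i))
    m₀≡ : m Fin.zero ≡ m′ Fin.zero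
    m₀≡ = ℕₚ.*-cancelˡ-≡ (m Fin.zero) (m′ Fin.zero) (suc a)
            (trans (ℕₚ.+-comm (m Fin.zero) _)
                   (trans (ℕₚ.+-cancelʳ-≡ (K Fin.zero) _ _ (same Fin.zero)) (ℕₚ.+-comm _ (m′ Fin.zero))))
  from : (∀ i → m i ≡ m′ i) → ∀ i → C i ≡ C′ i
  from m≡ i = ℕₚ.+-cancelʳ-≡ (X i) (C i) (C′ i)
                (trans (eq i) (trans (cong₂ (λ x y → a * x + y + K i) (m≡ Fin.zero) (m≡ i)) (sym (eq′ i))))

-- The content identity is
-- applied to λ and μ with a common origin B.
mainTheorem5 : (e : ℕ) .{{_ : NonZero e}} → 2 ≤ e → (l : ℕ) → 1 ≤ l →
    (s : Vec ℤ l) → InAlcove e l s →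
    (λs μs : MultiPartition l) (τλ τμ : Partition) →
    IsUglov e l s λs τλ → IsUglov e l s μs τμ →
    (Content e (sumℤ l s) τλ ≡ Content e (sumℤ l s) τμ)
    ⇔ (MultiContent e l s λs ≡ MultiContent e l s μs)
mainTheorem5 e@(suc _) (s≤s _) (suc l′) _ s _ λs μs τλ τμ (tλ , τλ≡) (tμ , τμ≡) =
  ⇔.trans (tabulate-≡ Cλ Cμ)
  (⇔.trans (affine-determines l′ X K Cλ Cμ mλ mμ identityλ identityμ)
           (⇔.sym (tabulate-≡ mλ mμ)))
  where
  -- one origin far enough below both abaci
  Bλ = uglovBound e l′ s λs tλ τλ
  Bμ = uglovBound e l′ s μs tμ τμ
  B = Bλ + Bμ
  X K Cλ Cμ mλ mμ : Fin e → ℕ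
  X i = uglovVacuum e l′ s B (toℕ i)
  K i = componentVacuum e l′ s B (toℕ i)
  Cλ i = contentCount e (sumℤ (suc l′) s) τλ (toℕ i)
  Cμ i = contentCount e (sumℤ (suc l′) s) τμ (toℕ i)
  mλ i = multiContentCount e (suc l′) s λs (toℕ i)
  mμ i = multiContentCount e (suc l′) s μs (toℕ i)
  identityλ : ∀ i → Cλ i + X i ≡ l′ * mλ Fin.zero + mλ i + K i
  identityλ i = uglov-content-identity e l′ s λs tλ τλ τλ≡ B (ℕₚ.m≤m+n Bλ Bμ) (toℕ i) (toℕ<n i)
  identityμ : ∀ i → Cμ i + X i ≡ l′ * mμ Fin.zero + mμ i + K i
  identityμ i = uglov-content-identity e l′ s μs tμ τμ τμ≡ B (ℕₚ.m≤n+m Bμ Bλ) (toℕ i) (toℕ<n i)
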